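{- For every square-free positive integer $q$ with $\gcd(q,6)=1$, one has $\Gamma(\mathrm{mod}\ q)=G(\mathrm{mod}\ q)$.
   Context: Let $\phi=\frac{1+\sqrt5}{2}$, and let $\Gamma\subset \mathrm{SL}_2(\mathbb Z[\phi])$ be the group generated by $\begin{pmatrix}1&\phi\\0&1\end{pmatrix}$, $\begin{pmatrix}1&0\\\phi&1\end{pmatrix}$, $\begin{pmatrix}\phi&\phi\\1&\phi\end{pmatrix}$, $\begin{pmatrix}\phi&1\\\phi&\phi\end{pmatrix}$. Let $G=\mathrm{SL}_2(\mathbb Z[\phi])$. For an integer $q\ge1$, $G(\mathrm{mod}\ q)$ and $\Gamma(\mathrm{mod}\ q)$ denote the images of $G$ and $\Gamma$ under the reduction map $\mathrm{SL}_2(\mathbb Z[\phi])\to\mathrm{SL}_2(\mathbb Z[\phi]/q\mathbb Z[\phi])$. -}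

module Defs where

open import Data.Nat as ℕ using (ℕ)
open import Data.Nat.Primality using (Prime)
open import Data.Nat.Divisibility using () renaming (_∣_ to _∣ℕ_)
open import Data.Integer using (ℤ; +_; -[1+_]; _-_; -_) renaming (_+_ to _+ℤ_; _*_ to _*ℤ_)
open import Data.Integer.Divisibility using () renaming (_∣_ to _∣ℤ_)
open import Data.Product using (Σ; _×_; _,_)
open import Data.Fin using (Fin)
open import Relation.Nullary using (¬_)
open import Relation.Binary.PropositionalEquality using (_≡_)

-- Z[φ] : elements a + b φ with a b ∈ ℤ, where φ² = φ + 1
record Zφ : Set where
  constructor _+_φ
  field
    re : ℤ
    im : ℤ
open Zφ public

infixl 6 _⊕_ _⊖_
infixl 7 _⊗_

_⊕_ : Zφ → Zφ → Zφ
(a + b φ) ⊕ (c + d φ) = (a +ℤ c) + (b +ℤ d) φ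

neg : Zφ → Zφ
neg (a + b φ) = (- a) + (- b) φ

_⊖_ : Zφ → Zφ → Zφ
x ⊖ y = x ⊕ neg y

-- (a + bφ)(c + dφ) = (ac + bd) + (ad + bc + bd)φ   since φ² = φ + 1
_⊗_ : Zφ → Zφ → Zφ
(a + b φ) ⊗ (c + d φ) = ((a *ℤ c) +ℤ (b *ℤ d)) + ((a *ℤ d) +ℤ (b *ℤ c) +ℤ (b *ℤ d)) φ

zeroφ oneφ φ : Zφ
zeroφ = (+ 0) + (+ 0) φ
oneφ  = (+ 1) + (+ 0) φ
φ     = (+ 0) + (+ 1) φ

-- congruence modulo q Z[φ]; since Z[φ] = Z ⊕ Zφ, q Z[φ] = qZ ⊕ qZφ
_≡φ_[mod_] : Zφ → Zφ → ℕ → Set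
x ≡φ y [mod q ] = ((+ q) ∣ℤ (re x - re y)) × ((+ q) ∣ℤ (im x - im y))

record Mat : Set where
  constructor mat
  field
    a b c d : Zφ
open Mat public

_·_ : Mat → Mat → Mat
mat a₁ b₁ c₁ d₁ · mat a₂ b₂ c₂ d₂ =
  mat (a₁ ⊗ a₂ ⊕ b₁ ⊗ c₂) (a₁ ⊗ b₂ ⊕ b₁ ⊗ d₂)
      (c₁ ⊗ a₂ ⊕ d₁ ⊗ c₂) (c₁ ⊗ b₂ ⊕ d₁ ⊗ d₂)

det : Mat → Zφ
det (mat a b c d) = a ⊗ d ⊖ b ⊗ c

-- inverse of a determinant-one matrix
adj : Mat → Mat
adj (mat a b c d) = mat d (neg b) (neg c) a

I₂ : Mat
I₂ = mat oneφ zeroφ zeroφ oneφ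

InSL2 : Mat → Set
InSL2 M = det M ≡ oneφ

gen : Fin 4 → Mat
gen Fin.zero = mat oneφ φ zeroφ oneφ
gen (Fin.suc Fin.zero) = mat oneφ zeroφ φ oneφ
gen (Fin.suc (Fin.suc Fin.zero)) = mat φ φ oneφ φ
gen (Fin.suc (Fin.suc (Fin.suc Fin.zero))) = mat φ oneφ φ φ

data InΓ : Mat → Set where
  idΓ  : InΓ I₂
  genR : ∀ {M} i → InΓ M → InΓ (M · gen i)
  invR : ∀ {M} i → InΓ M → InΓ (M · adj (gen i))

_≡M_[mod_] : Mat → Mat → ℕ → Set
M ≡M N [mod q ] =
  (a M ≡φ a N [mod q ]) × (b M ≡φ b N [mod q ]) ×
  (c M ≡φ c N [mod q ]) × (d M ≡φ d N [mod q ])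

-- Γ(mod q) ⊆ G(mod q) and G(mod q) ⊆ Γ(mod q), as images of reduction mod q
ImageΓ⊆ImageG : ℕ → Set
ImageΓ⊆ImageG q = ∀ M → InΓ M → Σ Mat (λ N → InSL2 N × (N ≡M M [mod q ]))

ImageG⊆ImageΓ : ℕ → Set
ImageG⊆ImageΓ q = ∀ N → InSL2 N → Σ Mat (λ M → InΓ M × (M ≡M N [mod q ]))

SameImage : ℕ → Set
SameImage q = ImageΓ⊆ImageG q × ImageG⊆ImageΓ q

SquareFree : ℕ → Set
SquareFree q = ∀ p → Prime p → ¬ ((p ℕ.* p) ∣ℕ q)

module Submission where

-- Γ lies in SL₂(ℤ[φ]) because its generators have determinant 1.  Conversely,
-- ℤ[φ] is Euclidean for |a² + ab − b²|, so SL₂(ℤ[φ]) is generated by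
-- S = (0 1; −1 0) and the unipotents E₁₂(x) = (1 x; 0 1), and Γ contains S and
-- every E₁₂(nφ) with n ∈ ℤ.  It therefore suffices to find an element of Γ
-- congruent to E₁₂(1) modulo q.  As gcd(q, 6) = 1, some m satisfies 12m ≡ 1;
-- conjugating E₁₂(mφ) by an element of Γ that is upper triangular modulo q with
-- top-left entry 2φ² gives E₁₂(4φ⁵m) = E₁₂(12m + 20mφ), and multiplying by
-- E₁₂(−20mφ) leaves E₁₂(12m) ≡ E₁₂(1).

open import Defs
open import Data.Nat using (ℕ; _≤_)
open import Data.Nat.GCD using (gcd)
open import Relation.Binary.PropositionalEquality using (_≡_)

open import Algebra.Bundles using (CommutativeRing)
open import Algebra.Structures using (IsCommutativeRing)
import Algebra.Solver.Ring.AlmostCommutativeRing as ACR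
import Algebra.Solver.Ring.Simple as RingSolver
import Data.Fin as Fin
open import Data.Fin using (#_)
open import Data.Integer using (ℤ; +_; -_; -[1+_]; ∣_∣)
import Data.Integer as ℤ
open import Data.Integer.Divisibility.Signed using (∣⇒∣ᵤ) renaming (divides to dividesℤ)
open import Data.Integer.DivMod using (_%ℕ_; _/ℕ_; a≡a%ℕn+[a/ℕn]*n; n%ℕd<d)
import Data.Integer.Properties as ℤₚ
open import Data.Integer.Tactic.RingSolver using (solve-∀)
open import Data.Nat using (zero; suc; s≤s; z≤n)
import Data.Nat as ℕ
open import Data.Nat.Divisibility using (divides)
open import Data.Nat.GCD using (GCD; gcd-GCD; module Bézout)
open import Data.Nat.Induction using (<-wellFounded)
open import Data.Nat.Primality using (Prime; prime?; euclidsLemma)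
import Data.Nat.Properties as ℕ
open import Data.Nat.Tactic.RingSolver using () renaming (solve-∀ to ℕ-solve-∀)
open import Data.Product using (Σ; _×_; _,_)
open import Data.Sum using ([_,_]′; inj₁; inj₂)
open import Function using (id; _∘_)
open import Induction.WellFounded using (Acc; acc)
open import Relation.Binary.Bundles using (Setoid)
open import Relation.Binary.Definitions using (Decidable)
open import Relation.Binary.PropositionalEquality
  using (_≢_; refl; sym; trans; cong; cong₂; subst; isEquivalence; module ≡-Reasoning)
import Relation.Binary.Reasoning.Setoid as SetoidReasoning
open import Relation.Nullary using (yes; no; contradiction)
open import Relation.Nullary.Decidable using (toWitness)

fromℤ : ℤ → Zφ
fromℤ n = n + + 0 φ

two : Zφ
two = fromℤ (+ 2)

⊕-assoc : ∀ x y z → (x ⊕ y) ⊕ z ≡ x ⊕ (y ⊕ z)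
⊕-assoc (a + b φ) (c + d φ) (e + f φ) = cong₂ _+_φ (ℤₚ.+-assoc a c e) (ℤₚ.+-assoc b d f)

⊕-comm : ∀ x y → x ⊕ y ≡ y ⊕ x
⊕-comm (a + b φ) (c + d φ) = cong₂ _+_φ (ℤₚ.+-comm a c) (ℤₚ.+-comm b d)

⊕-identityˡ : ∀ x → zeroφ ⊕ x ≡ x
⊕-identityˡ (a + b φ) = cong₂ _+_φ (ℤₚ.+-identityˡ a) (ℤₚ.+-identityˡ b)

⊕-identityʳ : ∀ x → x ⊕ zeroφ ≡ x
⊕-identityʳ x = trans (⊕-comm x zeroφ) (⊕-identityˡ x)

neg-inverseˡ : ∀ x → neg x ⊕ x ≡ zeroφ
neg-inverseˡ (a + b φ) = cong₂ _+_φ (ℤₚ.+-inverseˡ a) (ℤₚ.+-inverseˡ b)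

neg-inverseʳ : ∀ x → x ⊕ neg x ≡ zeroφ
neg-inverseʳ x = trans (⊕-comm x (neg x)) (neg-inverseˡ x)

⊗-assoc : ∀ x y z → (x ⊗ y) ⊗ z ≡ x ⊗ (y ⊗ z)
⊗-assoc (a + b φ) (c + d φ) (e + f φ) = cong₂ _+_φ (re-assoc a b c d e f) (im-assoc a b c d e f)
  where
  open Data.Integer using (_+_; _*_)
  re-assoc : ∀ a b c d e f →
    (a * c + b * d) * e + (a * d + b * c + b * d) * f
      ≡ a * (c * e + d * f) + b * (c * f + d * e + d * f)
  re-assoc = solve-∀
  im-assoc : ∀ a b c d e f →
    (a * c + b * d) * f + (a * d + b * c + b * d) * e + (a * d + b * c + b * d) * f
      ≡ a * (c * f + d * e + d * f) + b * (c * e + d * f) + b * (c * f + d * e + d * f)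
  im-assoc = solve-∀

⊗-comm : ∀ x y → x ⊗ y ≡ y ⊗ x
⊗-comm (a + b φ) (c + d φ) = cong₂ _+_φ (cong₂ ℤ._+_ (ℤₚ.*-comm a c) (ℤₚ.*-comm b d)) (im-comm a b c d)
  where
  open Data.Integer using (_+_; _*_)
  im-comm : ∀ a b c d → a * d + b * c + b * d ≡ c * b + d * a + d * b
  im-comm = solve-∀

⊗-identityˡ : ∀ x → oneφ ⊗ x ≡ x
⊗-identityˡ (a + b φ) = cong₂ _+_φ (re-identity a b) (im-identity a b)
  where
  open Data.Integer using (_+_; _*_)
  re-identity : ∀ a b → + 1 * a + + 0 * b ≡ a
  re-identity = solve-∀
  im-identity : ∀ a b → + 1 * b + + 0 * a + + 0 * b ≡ b
  im-identity = solve-∀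

⊗-identityʳ : ∀ x → x ⊗ oneφ ≡ x
⊗-identityʳ x = trans (⊗-comm x oneφ) (⊗-identityˡ x)

⊗-distribʳ-⊕ : ∀ x y z → (y ⊕ z) ⊗ x ≡ y ⊗ x ⊕ z ⊗ x
⊗-distribʳ-⊕ (a + b φ) (c + d φ) (e + f φ) = cong₂ _+_φ (re-distrib a b c d e f) (im-distrib a b c d e f)
  where
  open Data.Integer using (_+_; _*_)
  re-distrib : ∀ a b c d e f → (c + e) * a + (d + f) * b ≡ (c * a + d * b) + (e * a + f * b)
  re-distrib = solve-∀
  im-distrib : ∀ a b c d e f →
    (c + e) * b + (d + f) * a + (d + f) * b ≡ (c * b + d * a + d * b) + (e * b + f * a + f * b)
  im-distrib = solve-∀

⊗-distribˡ-⊕ : ∀ x y z → x ⊗ (y ⊕ z) ≡ x ⊗ y ⊕ x ⊗ z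
⊗-distribˡ-⊕ x y z = begin
  x ⊗ (y ⊕ z)     ≡⟨ ⊗-comm x (y ⊕ z) ⟩
  (y ⊕ z) ⊗ x     ≡⟨ ⊗-distribʳ-⊕ x y z ⟩
  y ⊗ x ⊕ z ⊗ x   ≡⟨ cong₂ _⊕_ (⊗-comm y x) (⊗-comm z x) ⟩
  x ⊗ y ⊕ x ⊗ z   ∎
  where open ≡-Reasoning

Zφ-isCommutativeRing : IsCommutativeRing _≡_ _⊕_ _⊗_ neg zeroφ oneφ
Zφ-isCommutativeRing = record
  { isRing = record
    { +-isAbelianGroup = record
      { isGroup = record
        { isMonoid = record
          { isSemigroup = record
            { isMagma = record { isEquivalence = isEquivalence ; ∙-cong = cong₂ _⊕_ }
            ; assoc = ⊕-assoc }
          ; identity = ⊕-identityˡ , ⊕-identityʳ }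
        ; inverse = neg-inverseˡ , neg-inverseʳ
        ; ⁻¹-cong = cong neg }
      ; comm = ⊕-comm }
    ; *-cong = cong₂ _⊗_
    ; *-assoc = ⊗-assoc
    ; *-identity = ⊗-identityˡ , ⊗-identityʳ
    ; distrib = ⊗-distribˡ-⊕ , ⊗-distribʳ-⊕ }
  ; *-comm = ⊗-comm }

Zφ-commutativeRing : CommutativeRing _ _
Zφ-commutativeRing = record { isCommutativeRing = Zφ-isCommutativeRing }

_≟φ_ : Decidable {A = Zφ} _≡_
(a + b φ) ≟φ (c + d φ) with a ℤₚ.≟ c | b ℤₚ.≟ d
... | yes refl | yes refl = yes refl
... | no a≢c   | _        = no λ { refl → a≢c refl }
... | _        | no b≢d   = no λ { refl → b≢d refl }

open RingSolver (ACR.fromCommutativeRing Zφ-commutativeRing) _≟φ_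

-- The norm and the Euclidean algorithm

norm : Zφ → ℤ
norm (a + b φ) = a ℤ.* a ℤ.+ a ℤ.* b ℤ.- b ℤ.* b

conj : Zφ → Zφ
conj (a + b φ) = (a ℤ.+ b) + (ℤ.- b) φ

module _ where
  open Data.Integer using (_+_; _*_; _-_; -_)

  ⊗-conj : ∀ x → x ⊗ conj x ≡ fromℤ (norm x)
  ⊗-conj (a + b φ) = cong₂ _+_φ (re-eq a b) (im-eq a b)
    where
    re-eq : ∀ a b → a * (a + b) + b * - b ≡ a * a + a * b - b * b
    re-eq = solve-∀
    im-eq : ∀ a b → a * - b + b * (a + b) + b * - b ≡ + 0
    im-eq = solve-∀

  norm-conj : ∀ x → norm (conj x) ≡ norm x
  norm-conj (a + b φ) = eq a b
    where
    eq : ∀ a b → (a + b) * (a + b) + (a + b) * - b - - b * - b ≡ a * a + a * b - b * b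
    eq = solve-∀

  norm-⊗ : ∀ x y → norm (x ⊗ y) ≡ norm x * norm y
  norm-⊗ (a + b φ) (c + d φ) = eq a b c d
    where
    eq : ∀ a b c d →
      let r = a * c + b * d ; i = a * d + b * c + b * d in
      r * r + r * i - i * i ≡ (a * a + a * b - b * b) * (c * c + c * d - d * d)
    eq = solve-∀

m²≡5n²⇒n≡0 : ∀ m n → m ℕ.* m ≡ 5 ℕ.* (n ℕ.* n) → n ≡ 0
m²≡5n²⇒n≡0 m n = descent n (<-wellFounded n) m
  where
  open Data.Nat using (_*_; _<_)
  5-prime : Prime 5
  5-prime = toWitness {a? = prime? 5} _
  descent : ∀ n → Acc _<_ n → ∀ m → m * m ≡ 5 * (n * n) → n ≡ 0
  descent zero _ _ _ = refl
  descent n@(suc _) (acc smaller) m m²≡5n²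
    with [ id , id ]′ (euclidsLemma m m 5-prime (divides (n * n) (trans m²≡5n² (ℕ.*-comm 5 (n * n)))))
  ... | divides k refl = finish k n²≡5k²
    where
    n²≡5k² : n * n ≡ 5 * (k * k)
    n²≡5k² = ℕ.*-cancelˡ-≡ _ _ 5 (trans (sym m²≡5n²) (regroup k))
      where
      regroup : ∀ k → k * 5 * (k * 5) ≡ 5 * (5 * (k * k))
      regroup = ℕ-solve-∀
    finish : ∀ k → n * n ≡ 5 * (k * k) → n ≡ 0
    finish zero n²≡0 = ℕ.m*n≡0⇒m≡0 n n n²≡0
    finish k@(suc _) n²≡5k² = contradiction (descent k (smaller k<n) n n²≡5k²) λ ()
      where
      k²<n² : k * k < n * n
      k²<n² = subst (k * k <_) (trans (ℕ.*-comm (k * k) 5) (sym n²≡5k²)) (ℕ.m<m*n (k * k) 5 (s≤s (s≤s z≤n)))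
      k<n : k < n
      k<n = ℕ.≰⇒> λ n≤k → ℕ.<⇒≱ k²<n² (ℕ.*-mono-≤ n≤k n≤k)

module _ where
  open Data.Integer using (_+_; _*_; _-_; -_; NonZero)

  i²≡5j²⇒j≡0 : ∀ i j → i * i ≡ + 5 * (j * j) → j ≡ + 0
  i²≡5j²⇒j≡0 i j i²≡5j² = ℤₚ.∣i∣≡0⇒i≡0 (m²≡5n²⇒n≡0 ∣ i ∣ ∣ j ∣ (begin
    ∣ i ∣ ℕ.* ∣ i ∣           ≡⟨ sym (ℤₚ.abs-* i i) ⟩
    ∣ i * i ∣                 ≡⟨ cong ∣_∣ i²≡5j² ⟩
    ∣ + 5 * (j * j) ∣         ≡⟨ ℤₚ.abs-* (+ 5) (j * j) ⟩
    5 ℕ.* ∣ j * j ∣           ≡⟨ cong (5 ℕ.*_) (ℤₚ.abs-* j j) ⟩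
    5 ℕ.* (∣ j ∣ ℕ.* ∣ j ∣)   ∎))
    where open ≡-Reasoning

  norm≡0⇒≡0 : ∀ x → norm x ≡ + 0 → x ≡ zeroφ
  norm≡0⇒≡0 x@(a + b φ) norm≡0 = cong₂ _+_φ
    (i²≡5j²⇒j≡0 (+ 2 * b - a) a (trans (completing-square₂ a b) (vanishing (+ 5 * (a * a)) (- + 4))))
    (i²≡5j²⇒j≡0 (+ 2 * a + b) b (trans (completing-square₁ a b) (vanishing (+ 5 * (b * b)) (+ 4))))
    where
    completing-square₁ : ∀ a b → (+ 2 * a + b) * (+ 2 * a + b) ≡ + 5 * (b * b) + + 4 * (a * a + a * b - b * b)
    completing-square₁ = solve-∀
    completing-square₂ : ∀ a b → (+ 2 * b - a) * (+ 2 * b - a) ≡ + 5 * (a * a) + - + 4 * (a * a + a * b - b * b)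
    completing-square₂ = solve-∀
    vanishing : ∀ i k → i + k * norm x ≡ i
    vanishing i k =
      trans (cong (λ n → i + k * n) norm≡0) (trans (cong (λ n → i + n) (ℤₚ.*-zeroʳ k)) (ℤₚ.+-identityʳ i))

  nearest-divisionℕ : ∀ u m .{{_ : ℕ.NonZero m}} →
                      Σ ℤ λ t → Σ ℤ λ r → u ≡ t * + m + r × 2 ℕ.* ∣ r ∣ ≤ m
  nearest-divisionℕ u m with 2 ℕ.* (u %ℕ m) ℕ.≤? m
  ... | yes 2ρ≤m =
    u /ℕ m , + (u %ℕ m) , trans (a≡a%ℕn+[a/ℕn]*n u m) (ℤₚ.+-comm (+ (u %ℕ m)) (u /ℕ m * + m)) , 2ρ≤m
  ... | no 2ρ≰m = u /ℕ m + + 1 , - + δ , u≡ , 2δ≤m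
    where
    ρ δ : ℕ
    ρ = u %ℕ m
    δ = m ℕ.∸ ρ
    m≡δ+ρ : + m ≡ + δ + + ρ
    m≡δ+ρ = trans (cong +_ (sym (ℕ.m∸n+n≡m (ℕ.<⇒≤ (n%ℕd<d u m))))) (ℤₚ.pos-+ δ ρ)
    round-up : ∀ ρ q δ → ρ + q * (δ + ρ) ≡ (q + + 1) * (δ + ρ) + - δ
    round-up = solve-∀
    u≡ : u ≡ (u /ℕ m + + 1) * + m + - + δ
    u≡ = begin
      u                                       ≡⟨ a≡a%ℕn+[a/ℕn]*n u m ⟩
      + ρ + u /ℕ m * + m                      ≡⟨ cong (λ k → + ρ + u /ℕ m * k) m≡δ+ρ ⟩
      + ρ + u /ℕ m * (+ δ + + ρ)              ≡⟨ round-up (+ ρ) (u /ℕ m) (+ δ) ⟩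
      (u /ℕ m + + 1) * (+ δ + + ρ) + - + δ    ≡⟨ cong (λ k → (u /ℕ m + + 1) * k + - + δ) m≡δ+ρ ⟨
      (u /ℕ m + + 1) * + m + - + δ            ∎
      where open ≡-Reasoning
    2δ≤m : 2 ℕ.* ∣ - + δ ∣ ≤ m
    2δ≤m rewrite ℤₚ.∣-i∣≡∣i∣ (+ δ) = ℕ.+-cancelʳ-≤ (2 ℕ.* ρ) (2 ℕ.* δ) m (begin
      2 ℕ.* δ ℕ.+ 2 ℕ.* ρ   ≡⟨ ℕ.*-distribˡ-+ 2 δ ρ ⟨
      2 ℕ.* (δ ℕ.+ ρ)       ≡⟨ cong (2 ℕ.*_) (ℕ.m∸n+n≡m (ℕ.<⇒≤ (n%ℕd<d u m))) ⟩
      2 ℕ.* m               ≡⟨ cong (m ℕ.+_) (ℕ.+-identityʳ m) ⟩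
      m ℕ.+ m               ≤⟨ ℕ.+-monoʳ-≤ m (ℕ.<⇒≤ (ℕ.≰⇒> 2ρ≰m)) ⟩
      m ℕ.+ 2 ℕ.* ρ         ∎)
      where open ℕ.≤-Reasoning

  nearest-division : ∀ u n .{{_ : NonZero n}} →
                     Σ ℤ λ t → Σ ℤ λ r → u ≡ t * n + r × 2 ℕ.* ∣ r ∣ ≤ ∣ n ∣
  nearest-division u n with nearest-divisionℕ u ∣ n ∣ | ℤₚ.+∣i∣≡i⊎+∣i∣≡-i n
  ... | t , r , u≡ , small | inj₁ ∣n∣≡n = t , r , subst (λ k → u ≡ t * k + r) ∣n∣≡n u≡ , small
  ... | t , r , u≡ , small | inj₂ ∣n∣≡-n = - t , r , trans u≡ (cong (_+ r) t∣n∣≡-tn) , small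
    where
    t∣n∣≡-tn : t * + ∣ n ∣ ≡ - t * n
    t∣n∣≡-tn = trans (cong (t *_) ∣n∣≡-n) (trans (sym (ℤₚ.neg-distribʳ-* t n)) (ℤₚ.neg-distribˡ-* t n))

  ∣norm∣≤ : ∀ z → let X = ∣ re z ∣ ; Y = ∣ im z ∣ in
            ∣ norm z ∣ ≤ X ℕ.* X ℕ.+ X ℕ.* Y ℕ.+ Y ℕ.* Y
  ∣norm∣≤ (x + y φ) = begin
    ∣ x * x + x * y - y * y ∣              ≤⟨ ℤₚ.∣i-j∣≤∣i∣+∣j∣ (x * x + x * y) (y * y) ⟩
    ∣ x * x + x * y ∣ ℕ.+ ∣ y * y ∣        ≤⟨ ℕ.+-monoˡ-≤ ∣ y * y ∣ (ℤₚ.∣i+j∣≤∣i∣+∣j∣ (x * x) (x * y)) ⟩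
    ∣ x * x ∣ ℕ.+ ∣ x * y ∣ ℕ.+ ∣ y * y ∣
      ≡⟨ cong₂ ℕ._+_ (cong₂ ℕ._+_ (ℤₚ.abs-* x x) (ℤₚ.abs-* x y)) (ℤₚ.abs-* y y) ⟩
    _                                      ∎
    where open ℕ.≤-Reasoning

  N*n≡norm⇒∣N∣<∣n∣ : ∀ N n z .{{_ : NonZero n}} → N * n ≡ norm z →
               2 ℕ.* ∣ re z ∣ ≤ ∣ n ∣ → 2 ℕ.* ∣ im z ∣ ≤ ∣ n ∣ → ∣ N ∣ ℕ.< ∣ n ∣
  N*n≡norm⇒∣N∣<∣n∣ N n z Nn≡norm 2X≤m 2Y≤m =
    ℕ.*-cancelʳ-< m ∣ N ∣ m (ℕ.*-cancelˡ-< 4 (∣ N ∣ ℕ.* m) (m ℕ.* m) (begin-strict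
      4 ℕ.* (∣ N ∣ ℕ.* m)                          ≡⟨ cong (4 ℕ.*_) (trans (sym (ℤₚ.abs-* N n)) (cong ∣_∣ Nn≡norm)) ⟩
      4 ℕ.* ∣ norm z ∣                             ≤⟨ ℕ.*-monoʳ-≤ 4 (∣norm∣≤ z) ⟩
      4 ℕ.* (X ℕ.* X ℕ.+ X ℕ.* Y ℕ.+ Y ℕ.* Y)      ≡⟨ by-doubling X Y ⟩
      2X ℕ.* 2X ℕ.+ 2X ℕ.* 2Y ℕ.+ 2Y ℕ.* 2Y         ≤⟨ ℕ.+-mono-≤ (ℕ.+-mono-≤ (ℕ.*-mono-≤ 2X≤m 2X≤m) (ℕ.*-mono-≤ 2X≤m 2Y≤m))
                                                                  (ℕ.*-mono-≤ 2Y≤m 2Y≤m) ⟩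
      m ℕ.* m ℕ.+ m ℕ.* m ℕ.+ m ℕ.* m              ≡⟨ tripling (m ℕ.* m) ⟩
      3 ℕ.* (m ℕ.* m)                              <⟨ ℕ.*-monoˡ-< (m ℕ.* m) {{ℕ.m*n≢0 m m}} (ℕ.n<1+n 3) ⟩
      4 ℕ.* (m ℕ.* m)                              ∎))
    where
    open ℕ.≤-Reasoning
    m X Y 2X 2Y : ℕ
    m = ∣ n ∣
    X = ∣ re z ∣
    Y = ∣ im z ∣
    2X = 2 ℕ.* X
    2Y = 2 ℕ.* Y
    by-doubling : ∀ X Y → 4 ℕ.* (X ℕ.* X ℕ.+ X ℕ.* Y ℕ.+ Y ℕ.* Y)
                        ≡ 2 ℕ.* X ℕ.* (2 ℕ.* X) ℕ.+ 2 ℕ.* X ℕ.* (2 ℕ.* Y) ℕ.+ 2 ℕ.* Y ℕ.* (2 ℕ.* Y)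
    by-doubling = ℕ-solve-∀
    tripling : ∀ k → k ℕ.+ k ℕ.+ k ≡ 3 ℕ.* k
    tripling = ℕ-solve-∀

Zφ-nearest-division : ∀ w n .{{_ : ℤ.NonZero n}} → Σ Zφ λ t → Σ Zφ λ r →
                      w ≡ t ⊗ fromℤ n ⊕ r × 2 ℕ.* ∣ re r ∣ ≤ ∣ n ∣ × 2 ℕ.* ∣ im r ∣ ≤ ∣ n ∣
Zφ-nearest-division (w₁ + w₂ φ) n with nearest-division w₁ n | nearest-division w₂ n
... | t₁ , r₁ , refl , small₁ | t₂ , r₂ , refl , small₂ =
  t₁ + t₂ φ , r₁ + r₂ φ , cong₂ _+_φ (re-eq t₁ t₂ n r₁) (im-eq t₁ t₂ n r₂) , small₁ , small₂
  where
  re-eq : ∀ t₁ t₂ n r → t₁ ℤ.* n ℤ.+ r ≡ t₁ ℤ.* n ℤ.+ t₂ ℤ.* + 0 ℤ.+ r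
  re-eq = solve-∀
  im-eq : ∀ t₁ t₂ n r → t₂ ℤ.* n ℤ.+ r ≡ t₁ ℤ.* + 0 ℤ.+ t₂ ℤ.* n ℤ.+ t₂ ℤ.* + 0 ℤ.+ r
  im-eq = solve-∀

norm-nonZero : ∀ c → c ≢ zeroφ → ℤ.NonZero (norm c)
norm-nonZero c c≢0 = ℤ.≢-nonZero (c≢0 ∘ norm≡0⇒≡0 c)

remainder-norm : ∀ a c t r → a ⊗ conj c ≡ t ⊗ fromℤ (norm c) ⊕ r → norm (a ⊖ t ⊗ c) ℤ.* norm c ≡ norm r
remainder-norm a c t r a·c̄≡ = begin
  norm (a ⊖ t ⊗ c) ℤ.* norm c            ≡⟨ cong (norm (a ⊖ t ⊗ c) ℤ.*_) (norm-conj c) ⟨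
  norm (a ⊖ t ⊗ c) ℤ.* norm (conj c)     ≡⟨ norm-⊗ (a ⊖ t ⊗ c) (conj c) ⟨
  norm ((a ⊖ t ⊗ c) ⊗ conj c)            ≡⟨ cong norm remainder ⟩
  norm r                                 ∎
  where
  open ≡-Reasoning
  remainder : (a ⊖ t ⊗ c) ⊗ conj c ≡ r
  remainder = begin
    (a ⊖ t ⊗ c) ⊗ conj c
      ≡⟨ solve 4 (λ a t c c̄ → (a :- t :* c) :* c̄ := a :* c̄ :- t :* (c :* c̄)) refl a t c (conj c) ⟩
    a ⊗ conj c ⊖ t ⊗ (c ⊗ conj c)
      ≡⟨ cong₂ (λ u v → u ⊖ t ⊗ v) a·c̄≡ (⊗-conj c) ⟩
    t ⊗ fromℤ (norm c) ⊕ r ⊖ t ⊗ fromℤ (norm c)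
      ≡⟨ solve 2 (λ x r → x :+ r :- x := r) refl (t ⊗ fromℤ (norm c)) r ⟩
    r
      ∎

euclidean : ∀ a c → c ≢ zeroφ → Σ Zφ λ t → ∣ norm (a ⊖ t ⊗ c) ∣ ℕ.< ∣ norm c ∣
euclidean a c c≢0 =
  let t , r , a·c̄≡ , small₁ , small₂ = Zφ-nearest-division (a ⊗ conj c) (norm c) {{nonZero}}
  in t , N*n≡norm⇒∣N∣<∣n∣ (norm (a ⊖ t ⊗ c)) (norm c) r {{nonZero}}
                          (remainder-norm a c t r a·c̄≡) small₁ small₂
  where
  nonZero : ℤ.NonZero (norm c)
  nonZero = norm-nonZero c c≢0

-- SL₂(ℤ[φ]) is generated by S and the E₁₂(x)

E₁₂ : Zφ → Mat
E₁₂ x = mat oneφ x zeroφ oneφ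

S : Mat
S = mat zeroφ oneφ (neg oneφ) zeroφ

mat-cong : ∀ {a b c d a′ b′ c′ d′} → a ≡ a′ → b ≡ b′ → c ≡ c′ → d ≡ d′ → mat a b c d ≡ mat a′ b′ c′ d′
mat-cong refl refl refl refl = refl

-- Matrices over solver polynomials, for normalising matrix products entrywise.
record PolyMat (n : ℕ) : Set where
  constructor pmat
  field
    pa pb pc pd : Polynomial n

infixl 7 _⊡_

_⊡_ : ∀ {n} → PolyMat n → PolyMat n → PolyMat n
pmat a₁ b₁ c₁ d₁ ⊡ pmat a₂ b₂ c₂ d₂ =
  pmat (a₁ :* a₂ :+ b₁ :* c₂) (a₁ :* b₂ :+ b₁ :* d₂) (c₁ :* a₂ :+ d₁ :* c₂) (c₁ :* b₂ :+ d₁ :* d₂)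

pE₁₂ : ∀ {n} → Polynomial n → PolyMat n
pE₁₂ x = pmat (con oneφ) x (con zeroφ) (con oneφ)

pS : ∀ {n} → PolyMat n
pS = pmat (con zeroφ) (con oneφ) (con (neg oneφ)) (con zeroφ)

padj : ∀ {n} → PolyMat n → PolyMat n
padj (pmat a b c d) = pmat d (:- b) (:- c) a

·-assoc : ∀ A B C → (A · B) · C ≡ A · (B · C)
·-assoc (mat a₁ b₁ c₁ d₁) (mat a₂ b₂ c₂ d₂) (mat a₃ b₃ c₃ d₃) =
  mat-cong (entry a₁ b₁ a₃ c₃) (entry a₁ b₁ b₃ d₃) (entry c₁ d₁ a₃ c₃) (entry c₁ d₁ b₃ d₃)
  where
  entry : ∀ x y u v → (x ⊗ a₂ ⊕ y ⊗ c₂) ⊗ u ⊕ (x ⊗ b₂ ⊕ y ⊗ d₂) ⊗ v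
                    ≡ x ⊗ (a₂ ⊗ u ⊕ b₂ ⊗ v) ⊕ y ⊗ (c₂ ⊗ u ⊕ d₂ ⊗ v)
  entry x y u v = solve 8 (λ x y u v a b c d → (x :* a :+ y :* c) :* u :+ (x :* b :+ y :* d) :* v
                                            := x :* (a :* u :+ b :* v) :+ y :* (c :* u :+ d :* v))
                          refl x y u v a₂ b₂ c₂ d₂

·-identityˡ : ∀ A → I₂ · A ≡ A
·-identityˡ (mat a b c d) = mat-cong (top a c) (top b d) (bottom a c) (bottom b d)
  where
  top : ∀ x y → oneφ ⊗ x ⊕ zeroφ ⊗ y ≡ x
  top = solve 2 (λ x y → con oneφ :* x :+ con zeroφ :* y := x) refl
  bottom : ∀ x y → zeroφ ⊗ x ⊕ oneφ ⊗ y ≡ y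
  bottom = solve 2 (λ x y → con zeroφ :* x :+ con oneφ :* y := y) refl

·-identityʳ : ∀ A → A · I₂ ≡ A
·-identityʳ (mat a b c d) = mat-cong (left a b) (right a b) (left c d) (right c d)
  where
  left : ∀ x y → x ⊗ oneφ ⊕ y ⊗ zeroφ ≡ x
  left = solve 2 (λ x y → x :* con oneφ :+ y :* con zeroφ := x) refl
  right : ∀ x y → x ⊗ zeroφ ⊕ y ⊗ oneφ ≡ y
  right = solve 2 (λ x y → x :* con zeroφ :+ y :* con oneφ := y) refl

adj-· : ∀ A B → adj (A · B) ≡ adj B · adj A
adj-· (mat a₁ b₁ c₁ d₁) (mat a₂ b₂ c₂ d₂) = mat-cong
  (solve 4 (λ c₁ b₂ d₁ d₂ → c₁ :* b₂ :+ d₁ :* d₂ := d₂ :* d₁ :+ (:- b₂) :* (:- c₁)) refl c₁ b₂ d₁ d₂)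
  (solve 4 (λ a₁ b₂ b₁ d₂ → :- (a₁ :* b₂ :+ b₁ :* d₂) := d₂ :* (:- b₁) :+ (:- b₂) :* a₁) refl a₁ b₂ b₁ d₂)
  (solve 4 (λ c₁ a₂ d₁ c₂ → :- (c₁ :* a₂ :+ d₁ :* c₂) := (:- c₂) :* d₁ :+ a₂ :* (:- c₁)) refl c₁ a₂ d₁ c₂)
  (solve 4 (λ a₁ a₂ b₁ c₂ → a₁ :* a₂ :+ b₁ :* c₂ := (:- c₂) :* (:- b₁) :+ a₂ :* a₁) refl a₁ a₂ b₁ c₂)

adj-involutive : ∀ A → adj (adj A) ≡ A
adj-involutive (mat a b c d) = mat-cong refl (neg-involutive b) (neg-involutive c) refl
  where
  neg-involutive : ∀ x → neg (neg x) ≡ x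
  neg-involutive = solve 1 (λ x → :- (:- x) := x) refl

det-· : ∀ A B → det (A · B) ≡ det A ⊗ det B
det-· (mat a₁ b₁ c₁ d₁) (mat a₂ b₂ c₂ d₂) =
  solve 8 (λ a₁ b₁ c₁ d₁ a₂ b₂ c₂ d₂ →
             (a₁ :* a₂ :+ b₁ :* c₂) :* (c₁ :* b₂ :+ d₁ :* d₂) :- (a₁ :* b₂ :+ b₁ :* d₂) :* (c₁ :* a₂ :+ d₁ :* c₂)
             := (a₁ :* d₁ :- b₁ :* c₁) :* (a₂ :* d₂ :- b₂ :* c₂))
          refl a₁ b₁ c₁ d₁ a₂ b₂ c₂ d₂

det-adj : ∀ A → det (adj A) ≡ det A
det-adj (mat a b c d) = solve 4 (λ a b c d → d :* a :- (:- b) :* (:- c) := a :* d :- b :* c) refl a b c d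

E₁₂-⊕ : ∀ x y → E₁₂ x · E₁₂ y ≡ E₁₂ (x ⊕ y)
E₁₂-⊕ x y = mat-cong
  (solve 2 (λ x y → con oneφ :* con oneφ :+ x :* con zeroφ := con oneφ) refl x y)
  (solve 2 (λ x y → con oneφ :* y :+ x :* con oneφ := x :+ y) refl x y)
  (solve 2 (λ x y → con zeroφ :* con oneφ :+ con oneφ :* con zeroφ := con zeroφ) refl x y)
  (solve 2 (λ x y → con zeroφ :* y :+ con oneφ :* con oneφ := con oneφ) refl x y)

record IsSubgroup (P : Mat → Set) : Set where
  field
    I₂∈ : P I₂
    ·-closed : ∀ {A B} → P A → P B → P (A · B)
    adj-closed : ∀ {A} → P A → P (adj A)

det-upper : ∀ a b d → det (mat a b zeroφ d) ≡ a ⊗ d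
det-upper = solve 3 (λ a b d → a :* d :- b :* con zeroφ := a :* d) refl

upper-triangular-product : ∀ a b d → a ⊗ d ≡ oneφ →
  E₁₂ a · (S · (E₁₂ d · (S · (E₁₂ a · (S · E₁₂ (d ⊗ b)))))) ≡ mat a b zeroφ d
upper-triangular-product a b d ad≡1 = begin
  E₁₂ a · (S · (E₁₂ d · (S · (E₁₂ a · (S · E₁₂ (d ⊗ b))))))   ≡⟨ mat-cong
     (solve 3 (λ a b d → PolyMat.pa (product a b d) := a :* (con two :- a :* d)) refl a b d)
     (solve 3 (λ a b d → PolyMat.pb (product a b d) := (con two :- a :* d) :* (a :* d) :* b :+ (a :* d :- con oneφ))
              refl a b d)
     (solve 3 (λ a b d → PolyMat.pc (product a b d) := con oneφ :- a :* d) refl a b d)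
     (solve 3 (λ a b d → PolyMat.pd (product a b d) := (con oneφ :- a :* d) :* d :* b :+ d) refl a b d) ⟩
  shape (a ⊗ d)                                                ≡⟨ cong shape ad≡1 ⟩
  shape oneφ                                                   ≡⟨ mat-cong
     (solve 1 (λ a → a :* (con two :- con oneφ) := a) refl a)
     (solve 1 (λ b → (con two :- con oneφ) :* con oneφ :* b :+ (con oneφ :- con oneφ) := b) refl b)
     refl
     (solve 2 (λ b d → (con oneφ :- con oneφ) :* d :* b :+ d := d) refl b d) ⟩
  mat a b zeroφ d                                              ∎
  where
  open ≡-Reasoning
  product : ∀ {n} → Polynomial n → Polynomial n → Polynomial n → PolyMat n
  product a b d = pE₁₂ a ⊡ (pS ⊡ (pE₁₂ d ⊡ (pS ⊡ (pE₁₂ a ⊡ (pS ⊡ pE₁₂ (d :* b))))))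
  -- the product with a ⊗ d abstracted to u, so that a ⊗ d ≡ oneφ can be substituted
  shape : Zφ → Mat
  shape u = mat (a ⊗ (two ⊖ u)) ((two ⊖ u) ⊗ u ⊗ b ⊕ (u ⊖ oneφ)) (oneφ ⊖ u) ((oneφ ⊖ u) ⊗ d ⊗ b ⊕ d)

E₁₂-S-reduction : ∀ a b c d t →
  E₁₂ t · (S · mat (neg c) (neg d) (a ⊖ t ⊗ c) (b ⊖ t ⊗ d)) ≡ mat a b c d
E₁₂-S-reduction a b c d t = mat-cong
  (solve 5 (λ a b c d t → PolyMat.pa (reduction a b c d t) := a) refl a b c d t)
  (solve 5 (λ a b c d t → PolyMat.pb (reduction a b c d t) := b) refl a b c d t)
  (solve 5 (λ a b c d t → PolyMat.pc (reduction a b c d t) := c) refl a b c d t)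
  (solve 5 (λ a b c d t → PolyMat.pd (reduction a b c d t) := d) refl a b c d t)
  where
  reduction : ∀ {n} → Polynomial n → Polynomial n → Polynomial n → Polynomial n → Polynomial n → PolyMat n
  reduction a b c d t = pE₁₂ t ⊡ (pS ⊡ pmat (:- c) (:- d) (a :- t :* c) (b :- t :* d))

det-reduction : ∀ a b c d t → det (mat (neg c) (neg d) (a ⊖ t ⊗ c) (b ⊖ t ⊗ d)) ≡ det (mat a b c d)
det-reduction = solve 5 (λ a b c d t → (:- c) :* (b :- t :* d) :- (:- d) :* (a :- t :* c) := a :* d :- b :* c) refl

module _ {P : Mat → Set} (P-subgroup : IsSubgroup P) where
  open IsSubgroup P-subgroup

  E₁₂-multiplesℕ : ∀ {x} → P (E₁₂ x) → ∀ n → P (E₁₂ (fromℤ (+ n) ⊗ x))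
  E₁₂-multiplesℕ {x} E₁₂x∈P zero =
    subst P (cong E₁₂ (solve 1 (λ x → con zeroφ := con zeroφ :* x) refl x)) I₂∈
  E₁₂-multiplesℕ {x} E₁₂x∈P (suc n) =
    subst P (trans (E₁₂-⊕ x (fromℤ (+ n) ⊗ x))
                   (cong E₁₂ (solve 2 (λ x m → x :+ m :* x := (con oneφ :+ m) :* x) refl x (fromℤ (+ n)))))
      (·-closed E₁₂x∈P (E₁₂-multiplesℕ E₁₂x∈P n))

  E₁₂-multiples : ∀ {x} → P (E₁₂ x) → ∀ n → P (E₁₂ (fromℤ n ⊗ x))
  E₁₂-multiples E₁₂x∈P (+ n) = E₁₂-multiplesℕ E₁₂x∈P n
  E₁₂-multiples {x} E₁₂x∈P -[1+ n ] =
    subst P (cong E₁₂ (solve 2 (λ x m → :- (m :* x) := (:- m) :* x) refl x (fromℤ (+ suc n))))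
      (adj-closed (E₁₂-multiplesℕ E₁₂x∈P (suc n)))

  E₁₂-all : P (E₁₂ oneφ) → P (E₁₂ φ) → ∀ x → P (E₁₂ x)
  E₁₂-all E₁₂1∈P E₁₂φ∈P (m + n φ) =
    subst P (trans (E₁₂-⊕ (fromℤ m ⊗ oneφ) (fromℤ n ⊗ φ)) (cong E₁₂ (fromℤ-⊕-φ m n)))
      (·-closed (E₁₂-multiples E₁₂1∈P m) (E₁₂-multiples E₁₂φ∈P n))
    where
    fromℤ-⊕-φ : ∀ m n → fromℤ m ⊗ oneφ ⊕ fromℤ n ⊗ φ ≡ m + n φ
    fromℤ-⊕-φ m n = cong₂ _+_φ (re-eq m n) (im-eq m n)
      where
      re-eq : ∀ m n → m ℤ.* + 1 ℤ.+ + 0 ℤ.+ (n ℤ.* + 0 ℤ.+ + 0) ≡ m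
      re-eq = solve-∀
      im-eq : ∀ m n → m ℤ.* + 0 ℤ.+ + 0 ℤ.+ + 0 ℤ.+ (n ℤ.* + 1 ℤ.+ + 0 ℤ.+ + 0) ≡ n
      im-eq = solve-∀

  module _ (S∈P : P S) (E₁₂∈P : ∀ x → P (E₁₂ x)) where

    upper-triangular∈ : ∀ a b d → a ⊗ d ≡ oneφ → P (mat a b zeroφ d)
    upper-triangular∈ a b d ad≡1 = subst P (upper-triangular-product a b d ad≡1)
      (·-closed (E₁₂∈P a) (·-closed S∈P (·-closed (E₁₂∈P d) (·-closed S∈P
        (·-closed (E₁₂∈P a) (·-closed S∈P (E₁₂∈P (d ⊗ b))))))))

    SL₂⊆ : ∀ N → InSL2 N → P N
    SL₂⊆ N = descend N (<-wellFounded ∣ norm (c N) ∣)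
      where
      descend : ∀ N → Acc ℕ._<_ ∣ norm (c N) ∣ → InSL2 N → P N
      descend (mat a b c d) (acc smaller) det≡1 with c ≟φ zeroφ
      ... | yes refl = upper-triangular∈ a b d (trans (sym (det-upper a b d)) det≡1)
      ... | no c≢0 =
        let t , norm-decreases = euclidean a c c≢0 in
        subst P (E₁₂-S-reduction a b c d t)
          (·-closed (E₁₂∈P t) (·-closed S∈P (descend (mat (neg c) (neg d) (a ⊖ t ⊗ c) (b ⊖ t ⊗ d))
                                                    (smaller norm-decreases)
                                                    (trans (det-reduction a b c d t) det≡1))))

InΓ⊆ : ∀ {P} → IsSubgroup P → (∀ i → P (gen i)) → ∀ {M} → InΓ M → P M
InΓ⊆ {P} P-subgroup gen∈P = go
  where
  open IsSubgroup P-subgroup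
  go : ∀ {M} → InΓ M → P M
  go idΓ = I₂∈
  go (genR i M∈Γ) = ·-closed (go M∈Γ) (gen∈P i)
  go (invR i M∈Γ) = ·-closed (go M∈Γ) (adj-closed (gen∈P i))

SL₂-isSubgroup : IsSubgroup InSL2
SL₂-isSubgroup = record
  { I₂∈ = refl
  ; ·-closed = λ {A} {B} detA≡1 detB≡1 → trans (det-· A B) (cong₂ _⊗_ detA≡1 detB≡1)
  ; adj-closed = λ {A} detA≡1 → trans (det-adj A) detA≡1
  }

Γ⊆SL₂ : ∀ {M} → InΓ M → InSL2 M
Γ⊆SL₂ = InΓ⊆ SL₂-isSubgroup gen-det
  where
  gen-det : ∀ i → det (gen i) ≡ oneφ
  gen-det Fin.zero = refl
  gen-det (Fin.suc Fin.zero) = refl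
  gen-det (Fin.suc (Fin.suc Fin.zero)) = refl
  gen-det (Fin.suc (Fin.suc (Fin.suc Fin.zero))) = refl

Γ-·-closed : ∀ {A B} → InΓ A → InΓ B → InΓ (A · B)
Γ-·-closed {A} A∈Γ idΓ = subst InΓ (sym (·-identityʳ A)) A∈Γ
Γ-·-closed {A} A∈Γ (genR {M} i M∈Γ) = subst InΓ (·-assoc A M (gen i)) (genR i (Γ-·-closed A∈Γ M∈Γ))
Γ-·-closed {A} A∈Γ (invR {M} i M∈Γ) = subst InΓ (·-assoc A M (adj (gen i))) (invR i (Γ-·-closed A∈Γ M∈Γ))

gen∈Γ : ∀ i → InΓ (gen i)
gen∈Γ i = subst InΓ (·-identityˡ (gen i)) (genR i idΓ)

Γ-adj-closed : ∀ {A} → InΓ A → InΓ (adj A)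
Γ-adj-closed idΓ = idΓ
Γ-adj-closed (genR {M} i M∈Γ) = subst InΓ (sym (adj-· M (gen i)))
  (Γ-·-closed (subst InΓ (·-identityˡ (adj (gen i))) (invR i idΓ)) (Γ-adj-closed M∈Γ))
Γ-adj-closed (invR {M} i M∈Γ) = subst InΓ (sym (adj-· M (adj (gen i))))
  (Γ-·-closed (subst InΓ (sym (adj-involutive (gen i))) (gen∈Γ i)) (Γ-adj-closed M∈Γ))

Γ-isSubgroup : IsSubgroup InΓ
Γ-isSubgroup = record { I₂∈ = idΓ ; ·-closed = Γ-·-closed ; adj-closed = Γ-adj-closed }

S∈Γ : InΓ S
S∈Γ = invR (# 1) (genR (# 3) (invR (# 1) idΓ))

E₁₂φ-multiples∈Γ : ∀ n → InΓ (E₁₂ (fromℤ n ⊗ φ))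
E₁₂φ-multiples∈Γ = E₁₂-multiples Γ-isSubgroup (gen∈Γ (# 0))

-- Congruences modulo a principal ideal Q ℤ[φ]

infix 4 _≈_⟨mod_⟩ _≈ₘ_⟨mod_⟩

record _≈_⟨mod_⟩ (x y Q : Zφ) : Set where
  constructor by-multiple
  field
    quotient : Zφ
    difference : x ≡ y ⊕ Q ⊗ quotient

module _ {Q : Zφ} where

  ≈-refl : ∀ {x} → x ≈ x ⟨mod Q ⟩
  ≈-refl {x} = by-multiple zeroφ (solve 2 (λ x Q → x := x :+ Q :* con zeroφ) refl x Q)

  ≈-sym : ∀ {x y} → x ≈ y ⟨mod Q ⟩ → y ≈ x ⟨mod Q ⟩
  ≈-sym {y = y} (by-multiple k refl) = by-multiple (neg k) (solve 3 (λ y Q k → y := (y :+ Q :* k) :+ Q :* (:- k)) refl y Q k)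

  ≈-trans : ∀ {x y z} → x ≈ y ⟨mod Q ⟩ → y ≈ z ⟨mod Q ⟩ → x ≈ z ⟨mod Q ⟩
  ≈-trans {z = z} (by-multiple k refl) (by-multiple l refl) =
    by-multiple (l ⊕ k) (solve 4 (λ z Q k l → (z :+ Q :* l) :+ Q :* k := z :+ Q :* (l :+ k)) refl z Q k l)

  ≈-⊕ : ∀ {x y u v} → x ≈ y ⟨mod Q ⟩ → u ≈ v ⟨mod Q ⟩ → x ⊕ u ≈ y ⊕ v ⟨mod Q ⟩
  ≈-⊕ {y = y} {v = v} (by-multiple k refl) (by-multiple l refl) =
    by-multiple (k ⊕ l) (solve 5 (λ y v Q k l → (y :+ Q :* k) :+ (v :+ Q :* l) := (y :+ v) :+ Q :* (k :+ l)) refl y v Q k l)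

  ≈-⊗ : ∀ {x y u v} → x ≈ y ⟨mod Q ⟩ → u ≈ v ⟨mod Q ⟩ → x ⊗ u ≈ y ⊗ v ⟨mod Q ⟩
  ≈-⊗ {y = y} {v = v} (by-multiple k refl) (by-multiple l refl) =
    by-multiple (k ⊗ v ⊕ y ⊗ l ⊕ Q ⊗ k ⊗ l)
      (solve 5 (λ y v Q k l → (y :+ Q :* k) :* (v :+ Q :* l) := y :* v :+ Q :* (k :* v :+ y :* l :+ Q :* k :* l)) refl y v Q k l)

  ≈-neg : ∀ {x y} → x ≈ y ⟨mod Q ⟩ → neg x ≈ neg y ⟨mod Q ⟩
  ≈-neg {y = y} (by-multiple k refl) = by-multiple (neg k) (solve 3 (λ y Q k → :- (y :+ Q :* k) := :- y :+ Q :* (:- k)) refl y Q k)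

record _≈ₘ_⟨mod_⟩ (M N : Mat) (Q : Zφ) : Set where
  constructor entrywise
  field
    a≈ : a M ≈ a N ⟨mod Q ⟩
    b≈ : b M ≈ b N ⟨mod Q ⟩
    c≈ : c M ≈ c N ⟨mod Q ⟩
    d≈ : d M ≈ d N ⟨mod Q ⟩

module _ {Q : Zφ} where

  ≈ₘ-refl : ∀ {M} → M ≈ₘ M ⟨mod Q ⟩
  ≈ₘ-refl = entrywise ≈-refl ≈-refl ≈-refl ≈-refl

  ≈ₘ-sym : ∀ {M N} → M ≈ₘ N ⟨mod Q ⟩ → N ≈ₘ M ⟨mod Q ⟩
  ≈ₘ-sym (entrywise a≈ b≈ c≈ d≈) = entrywise (≈-sym a≈) (≈-sym b≈) (≈-sym c≈) (≈-sym d≈)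

  ≈ₘ-trans : ∀ {M N L} → M ≈ₘ N ⟨mod Q ⟩ → N ≈ₘ L ⟨mod Q ⟩ → M ≈ₘ L ⟨mod Q ⟩
  ≈ₘ-trans (entrywise a≈ b≈ c≈ d≈) (entrywise a≈′ b≈′ c≈′ d≈′) =
    entrywise (≈-trans a≈ a≈′) (≈-trans b≈ b≈′) (≈-trans c≈ c≈′) (≈-trans d≈ d≈′)

  ≈ₘ-· : ∀ {M N M′ N′} → M ≈ₘ N ⟨mod Q ⟩ → M′ ≈ₘ N′ ⟨mod Q ⟩ → M · M′ ≈ₘ N · N′ ⟨mod Q ⟩
  ≈ₘ-· {mat _ _ _ _} {mat _ _ _ _} {mat _ _ _ _} {mat _ _ _ _} (entrywise a≈ b≈ c≈ d≈) (entrywise a≈′ b≈′ c≈′ d≈′) =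
    entrywise (≈-⊕ (≈-⊗ a≈ a≈′) (≈-⊗ b≈ c≈′)) (≈-⊕ (≈-⊗ a≈ b≈′) (≈-⊗ b≈ d≈′))
              (≈-⊕ (≈-⊗ c≈ a≈′) (≈-⊗ d≈ c≈′)) (≈-⊕ (≈-⊗ c≈ b≈′) (≈-⊗ d≈ d≈′))

  ≈ₘ-adj : ∀ {M N} → M ≈ₘ N ⟨mod Q ⟩ → adj M ≈ₘ adj N ⟨mod Q ⟩
  ≈ₘ-adj {mat _ _ _ _} {mat _ _ _ _} (entrywise a≈ b≈ c≈ d≈) = entrywise d≈ (≈-neg b≈) (≈-neg c≈) a≈

  E₁₂-≈ : ∀ {x y} → x ≈ y ⟨mod Q ⟩ → E₁₂ x ≈ₘ E₁₂ y ⟨mod Q ⟩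
  E₁₂-≈ x≈y = entrywise ≈-refl x≈y ≈-refl ≈-refl

≈ₘ-setoid : Zφ → Setoid _ _
≈ₘ-setoid Q = record
  { Carrier = Mat
  ; _≈_ = _≈ₘ_⟨mod Q ⟩
  ; isEquivalence = record { refl = ≈ₘ-refl ; sym = ≈ₘ-sym ; trans = ≈ₘ-trans }
  }

module ≈ₘ-Reasoning (Q : Zφ) = SetoidReasoning (≈ₘ-setoid Q)

_mod_ : (Mat → Set) → Zφ → Mat → Set
(P mod Q) N = Σ Mat λ M → P M × M ≈ₘ N ⟨mod Q ⟩

module _ {P : Mat → Set} {Q : Zφ} where

  ⊆mod : ∀ {N} → P N → (P mod Q) N
  ⊆mod {N} N∈P = N , N∈P , ≈ₘ-refl

  mod-isSubgroup : IsSubgroup P → IsSubgroup (P mod Q)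
  mod-isSubgroup P-subgroup = record
    { I₂∈ = ⊆mod I₂∈
    ; ·-closed = λ (M , M∈P , M≈) (M′ , M′∈P , M′≈) → M · M′ , ·-closed M∈P M′∈P , ≈ₘ-· M≈ M′≈
    ; adj-closed = λ (M , M∈P , M≈) → adj M , adj-closed M∈P , ≈ₘ-adj M≈
    }
    where open IsSubgroup P-subgroup

≈⇒≡φ[mod] : ∀ {x y q} → x ≈ y ⟨mod fromℤ (+ q) ⟩ → x ≡φ y [mod q ]
≈⇒≡φ[mod] {y = y₁ + y₂ φ} {q} (by-multiple (k₁ + k₂ φ) refl) =
  ∣⇒∣ᵤ (dividesℤ k₁ (re-eq y₁ k₁ k₂ (+ q))) , ∣⇒∣ᵤ (dividesℤ k₂ (im-eq y₂ k₁ k₂ (+ q)))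
  where
  open Data.Integer using (_+_; _*_; _-_)
  re-eq : ∀ y k₁ k₂ q → y + (q * k₁ + + 0 * k₂) - y ≡ k₁ * q
  re-eq = solve-∀
  im-eq : ∀ y k₁ k₂ q → y + (q * k₂ + + 0 * k₁ + + 0 * k₂) - y ≡ k₂ * q
  im-eq = solve-∀

≈ₘ⇒≡M[mod] : ∀ {M N q} → M ≈ₘ N ⟨mod fromℤ (+ q) ⟩ → M ≡M N [mod q ]
≈ₘ⇒≡M[mod] (entrywise a≈ b≈ c≈ d≈) = ≈⇒≡φ[mod] a≈ , ≈⇒≡φ[mod] b≈ , ≈⇒≡φ[mod] c≈ , ≈⇒≡φ[mod] d≈

-- E₁₂(1) lies in Γ modulo q

S-E₁₂-action : ∀ t a b c d → S · (E₁₂ t · mat a b c d) ≡ mat c d (neg (a ⊕ t ⊗ c)) (neg (b ⊕ t ⊗ d))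
S-E₁₂-action t a b c d = mat-cong
  (solve 5 (λ t a b c d → PolyMat.pa (action t a b c d) := c) refl t a b c d)
  (solve 5 (λ t a b c d → PolyMat.pb (action t a b c d) := d) refl t a b c d)
  (solve 5 (λ t a b c d → PolyMat.pc (action t a b c d) := :- (a :+ t :* c)) refl t a b c d)
  (solve 5 (λ t a b c d → PolyMat.pd (action t a b c d) := :- (b :+ t :* d)) refl t a b c d)
  where
  action : ∀ {n} → Polynomial n → Polynomial n → Polynomial n → Polynomial n → Polynomial n → PolyMat n
  action t a b c d = pS ⊡ (pE₁₂ t ⊡ pmat a b c d)

conjugate-E₁₂ : ∀ G x → det G ≡ oneφ → (G · E₁₂ x) · adj G ≡
  mat (oneφ ⊖ a G ⊗ c G ⊗ x) (a G ⊗ a G ⊗ x) (neg (c G ⊗ c G ⊗ x)) (oneφ ⊕ a G ⊗ c G ⊗ x)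
conjugate-E₁₂ (mat a b c d) x detG≡1 = trans (mat-cong
  (solve 5 (λ a b c d x → PolyMat.pa (conjugate a b c d x) := (a :* d :- b :* c) :- a :* c :* x) refl a b c d x)
  (solve 5 (λ a b c d x → PolyMat.pb (conjugate a b c d x) := a :* a :* x) refl a b c d x)
  (solve 5 (λ a b c d x → PolyMat.pc (conjugate a b c d x) := :- (c :* c :* x)) refl a b c d x)
  (solve 5 (λ a b c d x → PolyMat.pd (conjugate a b c d x) := (a :* d :- b :* c) :+ a :* c :* x) refl a b c d x))
  (cong (λ δ → mat (δ ⊖ a ⊗ c ⊗ x) (a ⊗ a ⊗ x) (neg (c ⊗ c ⊗ x)) (δ ⊕ a ⊗ c ⊗ x)) detG≡1)
  where
  conjugate : ∀ {n} → Polynomial n → Polynomial n → Polynomial n → Polynomial n → Polynomial n → PolyMat n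
  conjugate a b c d x = (pmat a b c d ⊡ pE₁₂ x) ⊡ padj (pmat a b c d)

conjugate-E₁₂-mod : ∀ {Q} G x → det G ≡ oneφ → c G ≈ zeroφ ⟨mod Q ⟩ →
                    (G · E₁₂ x) · adj G ≈ₘ E₁₂ (a G ⊗ a G ⊗ x) ⟨mod Q ⟩
conjugate-E₁₂-mod {Q} G@(mat a _ _ _) x detG≡1 (by-multiple k refl) =
  subst (_≈ₘ E₁₂ (a ⊗ a ⊗ x) ⟨mod Q ⟩) (sym (conjugate-E₁₂ G x detG≡1)) (entrywise
    (by-multiple (neg (a ⊗ k ⊗ x)) (solve 4 (λ a k x Q → con oneφ :- a :* (con zeroφ :+ Q :* k) :* x
                                                    := con oneφ :+ Q :* (:- (a :* k :* x))) refl a k x Q))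
    ≈-refl
    (by-multiple (neg (k ⊗ Q ⊗ k ⊗ x)) (solve 3 (λ k x Q → :- ((con zeroφ :+ Q :* k) :* (con zeroφ :+ Q :* k) :* x)
                                                    := con zeroφ :+ Q :* (:- (k :* Q :* k :* x))) refl k x Q))
    (by-multiple (a ⊗ k ⊗ x) (solve 4 (λ a k x Q → con oneφ :+ a :* (con zeroφ :+ Q :* k) :* x
                                                    := con oneφ :+ Q :* (a :* k :* x)) refl a k x Q)))

fromℤ-* : ∀ i j → fromℤ (i ℤ.* j) ≡ fromℤ i ⊗ fromℤ j
fromℤ-* i j = cong₂ _+_φ (sym (ℤₚ.+-identityʳ (i ℤ.* j))) (im-eq i j)
  where
  im-eq : ∀ i j → + 0 ≡ i ℤ.* + 0 ℤ.+ + 0 ℤ.* j ℤ.+ + 0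
  im-eq = solve-∀

fromℤ-≈ : ∀ {i j} q k → i ≡ j ℤ.+ + q ℤ.* k → fromℤ i ≈ fromℤ j ⟨mod fromℤ (+ q) ⟩
fromℤ-≈ {j = j} q k refl = by-multiple (fromℤ k) (cong (fromℤ j ⊕_) (fromℤ-* (+ q) k))

φ² φ³ : Zφ
φ² = φ ⊗ φ
φ³ = φ ⊗ φ²

W : Mat
W = S · (E₁₂ φ · (S · (E₁₂ (two ⊗ φ) · (S · (E₁₂ φ · S)))))

W∈Γ : InΓ W
W∈Γ = Γ-·-closed S∈Γ (Γ-·-closed (gen∈Γ (# 0)) (Γ-·-closed S∈Γ (Γ-·-closed (E₁₂φ-multiples∈Γ (+ 2))
        (Γ-·-closed S∈Γ (Γ-·-closed (gen∈Γ (# 0)) S∈Γ)))))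

W-entries : W ≡ mat (neg φ³) (two ⊗ φ) (two ⊗ φ²) (neg φ³)
W-entries = refl

G : Zφ → Mat
G t = mat (two ⊗ φ²) (neg φ³) (neg (neg φ³ ⊕ t ⊗ (two ⊗ φ²))) (neg (two ⊗ φ ⊕ t ⊗ neg φ³))

G∈Γ : ∀ m → InΓ (G (fromℤ m ⊗ (fromℤ (+ 6) ⊗ φ)))
G∈Γ m = subst InΓ (S-E₁₂-action (fromℤ m ⊗ (fromℤ (+ 6) ⊗ φ)) (neg φ³) (two ⊗ φ) (two ⊗ φ²) (neg φ³))
  (Γ-·-closed S∈Γ (Γ-·-closed (E₁₂-multiples Γ-isSubgroup (E₁₂φ-multiples∈Γ (+ 6)) m) (subst InΓ W-entries W∈Γ)))

-- W has first column (−φ³, 2φ²), so the lower-left entry φ³ − 2φ²t of G t = S · E₁₂ t · W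
-- vanishes for t = φ/2, which is 6mφ modulo Q.
G-lower-left≈0 : ∀ {Q} m → fromℤ (+ 12) ⊗ fromℤ m ≈ oneφ ⟨mod Q ⟩ →
                 c (G (fromℤ m ⊗ (fromℤ (+ 6) ⊗ φ))) ≈ zeroφ ⟨mod Q ⟩
G-lower-left≈0 {Q} m (by-multiple k 12m≡1+Qk) = by-multiple (neg (k ⊗ φ³)) (begin
  neg (neg φ³ ⊕ M ⊗ (fromℤ (+ 6) ⊗ φ) ⊗ (two ⊗ φ²))
    ≡⟨ solve 1 (λ M → :- (:- con φ³ :+ M :* (con (fromℤ (+ 6)) :* con φ) :* (con two :* con φ²))
                    := :- ((con (fromℤ (+ 12)) :* M :- con oneφ) :* con φ³)) refl M ⟩
  neg ((fromℤ (+ 12) ⊗ M ⊖ oneφ) ⊗ φ³)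
    ≡⟨ cong (λ u → neg ((u ⊖ oneφ) ⊗ φ³)) 12m≡1+Qk ⟩
  neg ((oneφ ⊕ Q ⊗ k ⊖ oneφ) ⊗ φ³)
    ≡⟨ solve 2 (λ Q k → :- ((con oneφ :+ Q :* k :- con oneφ) :* con φ³)
                      := con zeroφ :+ Q :* (:- (k :* con φ³))) refl Q k ⟩
  zeroφ ⊕ Q ⊗ neg (k ⊗ φ³)
    ∎)
  where
  open ≡-Reasoning
  M : Zφ
  M = fromℤ m

E₁₂-one∈Γ-mod : ∀ {Q} m → fromℤ (+ 12) ⊗ fromℤ m ≈ oneφ ⟨mod Q ⟩ → (InΓ mod Q) (E₁₂ oneφ)
E₁₂-one∈Γ-mod {Q} m 12m≈1 = U , U∈Γ , U≈E₁₂1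
  where
  M x y : Zφ
  M = fromℤ m
  x = M ⊗ φ
  y = M ⊗ (fromℤ (- + 20) ⊗ φ)
  Gₘ : Mat
  Gₘ = G (M ⊗ (fromℤ (+ 6) ⊗ φ))
  U : Mat
  U = ((Gₘ · E₁₂ x) · adj Gₘ) · E₁₂ y
  U∈Γ : InΓ U
  U∈Γ = Γ-·-closed (Γ-·-closed (Γ-·-closed (G∈Γ m) (E₁₂φ-multiples∈Γ m)) (Γ-adj-closed (G∈Γ m)))
          (E₁₂-multiples Γ-isSubgroup (E₁₂φ-multiples∈Γ (- + 20)) m)
  U≈E₁₂1 : U ≈ₘ E₁₂ oneφ ⟨mod Q ⟩
  U≈E₁₂1 = begin
    ((Gₘ · E₁₂ x) · adj Gₘ) · E₁₂ y
      ≈⟨ ≈ₘ-· (conjugate-E₁₂-mod Gₘ x (Γ⊆SL₂ (G∈Γ m)) (G-lower-left≈0 m 12m≈1)) ≈ₘ-refl ⟩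
    E₁₂ (two ⊗ φ² ⊗ (two ⊗ φ²) ⊗ x) · E₁₂ y
      ≡⟨ E₁₂-⊕ (two ⊗ φ² ⊗ (two ⊗ φ²) ⊗ x) y ⟩
    E₁₂ (two ⊗ φ² ⊗ (two ⊗ φ²) ⊗ x ⊕ y)
      ≡⟨ cong E₁₂ (solve 1 (λ M → con two :* con φ² :* (con two :* con φ²) :* (M :* con φ)
                                   :+ M :* (con (fromℤ (- + 20)) :* con φ)
                                   := con (fromℤ (+ 12)) :* M) refl M) ⟩
    E₁₂ (fromℤ (+ 12) ⊗ M)
      ≈⟨ E₁₂-≈ 12m≈1 ⟩
    E₁₂ oneφ
      ∎
    where open ≈ₘ-Reasoning Q

ℕ-Bézout⇒ℤ : ∀ a b c d → 1 ℕ.+ a ℕ.* b ≡ c ℕ.* d → + 1 ℤ.+ + a ℤ.* + b ≡ + c ℤ.* + d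
ℕ-Bézout⇒ℤ a b c d eq = begin
  + 1 ℤ.+ + a ℤ.* + b      ≡⟨ cong (λ z → + 1 ℤ.+ z) (ℤₚ.pos-* a b) ⟨
  + 1 ℤ.+ + (a ℕ.* b)      ≡⟨ ℤₚ.pos-+ 1 (a ℕ.* b) ⟨
  + (1 ℕ.+ a ℕ.* b)        ≡⟨ cong +_ eq ⟩
  + (c ℕ.* d)              ≡⟨ ℤₚ.pos-* c d ⟩
  + c ℤ.* + d              ∎
  where open ≡-Reasoning

gcd≡1⇒invertible : ∀ q n → gcd q n ≡ 1 → Σ ℤ λ a → Σ ℤ λ k → + n ℤ.* a ≡ + 1 ℤ.+ + q ℤ.* k
gcd≡1⇒invertible q n gcd≡1 with Bézout.identity (subst (GCD q n) gcd≡1 (gcd-GCD q n))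
... | Bézout.+- x y 1+yn≡xq = - + y , - + x , (begin
  + n * - + y              ≡⟨ negate (+ n) (+ y) ⟩
  + 1 - (+ 1 + + y * + n)  ≡⟨ cong (λ z → + 1 - z) (ℕ-Bézout⇒ℤ y n x q 1+yn≡xq) ⟩
  + 1 - + x * + q          ≡⟨ rearrange (+ x) (+ q) ⟩
  + 1 + + q * - + x        ∎)
  where
  open ≡-Reasoning
  open Data.Integer using (_+_; _*_; _-_; -_)
  negate : ∀ n y → n * - y ≡ + 1 - (+ 1 + y * n)
  negate = solve-∀
  rearrange : ∀ x q → + 1 - x * q ≡ + 1 + q * - x
  rearrange = solve-∀
... | Bézout.-+ x y 1+xq≡yn = + y , + x , (begin
  + n * + y                ≡⟨ ℤₚ.*-comm (+ n) (+ y) ⟩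
  + y * + n                ≡⟨ ℕ-Bézout⇒ℤ x q y n 1+xq≡yn ⟨
  + 1 + + x * + q          ≡⟨ cong (λ z → + 1 + z) (ℤₚ.*-comm (+ x) (+ q)) ⟩
  + 1 + + q * + x          ∎)
  where
  open ≡-Reasoning
  open Data.Integer using (_+_; _*_)

12-invertible : ∀ q → gcd q 6 ≡ 1 → Σ ℤ λ m → Σ ℤ λ k → + 12 ℤ.* m ≡ + 1 ℤ.+ + q ℤ.* k
12-invertible q gcd≡1 =
  let a , k , 6a≡1+qk = gcd≡1⇒invertible q 6 gcd≡1 in
  + 3 ℤ.* a ℤ.* a , + 2 ℤ.* k ℤ.+ + q ℤ.* k ℤ.* k , (begin
    + 12 * (+ 3 * a * a)                      ≡⟨ square-of-6 a ⟩
    (+ 6 * a) * (+ 6 * a)                     ≡⟨ cong₂ _*_ 6a≡1+qk 6a≡1+qk ⟩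
    (+ 1 + + q * k) * (+ 1 + + q * k)         ≡⟨ square-of-1+ (+ q) k ⟩
    + 1 + + q * (+ 2 * k + + q * k * k)       ∎)
  where
  open ≡-Reasoning
  open Data.Integer using (_+_; _*_)
  square-of-6 : ∀ a → + 12 * (+ 3 * a * a) ≡ (+ 6 * a) * (+ 6 * a)
  square-of-6 = solve-∀
  square-of-1+ : ∀ q k → (+ 1 + q * k) * (+ 1 + q * k) ≡ + 1 + q * (+ 2 * k + q * k * k)
  square-of-1+ = solve-∀

lemma3p4 : (q : ℕ) → 1 ≤ q → SquareFree q → gcd q 6 ≡ 1 → SameImage q
lemma3p4 q _ _ gcd≡1 = Γ⊆G , G⊆Γ
  where
  Q : Zφ
  Q = fromℤ (+ q)
  Γ-mod-q : IsSubgroup (InΓ mod Q)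
  Γ-mod-q = mod-isSubgroup Γ-isSubgroup
  Γ⊆G : ImageΓ⊆ImageG q
  Γ⊆G M M∈Γ = M , Γ⊆SL₂ M∈Γ , ≈ₘ⇒≡M[mod] {M} {M} ≈ₘ-refl
  E₁₂-one∈Γ-mod-q : (InΓ mod Q) (E₁₂ oneφ)
  E₁₂-one∈Γ-mod-q =
    let m , k , 12m≡1+qk = 12-invertible q gcd≡1 in
    E₁₂-one∈Γ-mod m (subst (_≈ oneφ ⟨mod Q ⟩) (fromℤ-* (+ 12) m) (fromℤ-≈ q k 12m≡1+qk))
  G⊆Γ : ImageG⊆ImageΓ q
  G⊆Γ N N∈G =
    let E₁₂∈Γ-mod-q = E₁₂-all Γ-mod-q E₁₂-one∈Γ-mod-q (⊆mod (gen∈Γ (# 0)))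
        M , M∈Γ , M≈N = SL₂⊆ Γ-mod-q (⊆mod S∈Γ) E₁₂∈Γ-mod-q N N∈G
    in M , M∈Γ , ≈ₘ⇒≡M[mod] M≈N
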